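{- Let $n\ge 2$. The ternary relations $\mathcal T\big((C\overline{\mathcal K}_n)^{(2)}\big)$ and $\mathcal T(B_n)$ are isomorphic. Consequently, under the induced identification of coordinates, $P\big((C\overline{\mathcal K}_n)^{(2)}\big)=P(B_n)$.
   Context: A (symmetric) ternary relation is a pair $\mathcal T=(\Sigma,R)$ where $\Sigma$ is a finite set and $R$ is a set of unordered triples $[i,j,k]$ of elements of $\Sigma$. Two ternary relations $(\Sigma_1,R_1)$, $(\Sigma_2,R_2)$ are isomorphic if there is a bijection $\phi:\Sigma_1\to\Sigma_2$ such that $[i,j,k]\in R_1$ iff $[\phi(i),\phi(j),\phi(k)]\in R_2$. The ternary polytope is $P(\mathcal T)=\mathrm{Conv}\{\mathbf 1_i+\mathbf 1_j-\mathbf 1_k,\ \mathbf 1_i-\mathbf 1_j+\mathbf 1_k,\ -\mathbf 1_i+\mathbf 1_j+\mathbf 1_k : [i,j,k]\in R\}\subset\mathbb R^{\Sigma}$. For a finite configuration $\Omega=\{\pm\alpha_1,\dots,\pm\alpha_m\}\subset\mathbb R^d$ with $\Omega=-\Omega$, $\mathcal T(\Omega)=(\{1,\dots,m\},R_\Omega)$ where $R_\Omega$ is the set of triples $[i,j,k]$ with $\pm\alpha_i\pm\alpha_j\pm\alpha_k=0$ for some choice of signs; $P(\Omega):=P(\mathcal T(\Omega))$. The root system $B_n$ is $\{\pm(\varepsilon_i-\varepsilon_j),\pm(\varepsilon_i+\varepsilon_j):1\le i<j\le n\}\cup\{\pm\varepsilon_i:1\le i\le n\}\subset\mathbb R^n$.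 For a $2$-dimensional simplicial poset $\mathcal P$ (a poset with minimum $\hat0$ all of whose lower intervals $[\hat0,x]$ are Boolean lattices; vertices, edges, triangles are the elements with $[\hat 0,x]$ Boolean on $1,2,3$ elements), $\mathcal T(\mathcal P)=(\mathcal P(1),R_{\mathcal P})$ where $\mathcal P(1)$ is the set of edges and $R_{\mathcal P}$ is the set of triples $[e_1,e_2,e_3]$ such that $e_1,e_2,e_3$ are the three edge facets of a triangle; $P(\mathcal P):=P(\mathcal T(\mathcal P))$. The simplicial poset $(C\overline{\mathcal K}_n)^{(2)}$ (the $2$-skeleton of the cone over $\overline{\mathcal K}_n$) is explicitly: a minimum $\hat0$; vertices $v_0,v_1,\dots,v_n$; edges $e_{ij}=e_{ji}$ and $e^i_j=e^j_i$ for $1\le i\ne j\le n$, both with endpoints $v_i,v_j$, and edges $e_i$ ($1\le i\le n$) with endpoints $v_0,v_i$; triangles $\Delta_{ijk}$ (for each $3$-subset $\{i,j,k\}\subset\{1,\dots,n\}$) with facets $e_{ij},e_{jk},e_{ik}$; triangles $\Delta^i_{jk}=\Delta^i_{kj}$ (pairwise distinct $i,j,k\in\{1,\dots,n\}$) with facets $e^i_j,e^i_k,e_{jk}$; triangles $\Delta_{ij}=\Delta_{ji}$ with facets $e_i,e_{ij},e_j$; and triangles $\Delta^i_j=\Delta^j_i$ with facets $e_i,e^i_j,e_j$ ($1\le i\neq j\le n$). Each triangle's vertex faces are the endpoints of its facets, and the order is generated by these face relations.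
   Formalization: The ternary polytopes are taken over the rationals: their points have rational coordinates and are convex combinations with rational coefficients, rather than points of $\mathbb R^{\Sigma}$. -}

module Defs where

open import Data.Nat using (ℕ)
open import Data.Fin using (Fin; _<_)
open import Data.Fin.Properties using (<-cmp; <-irrelevant) renaming (_≟_ to _≟F_)
open import Data.Integer using (ℤ; +_; -_) renaming (_+_ to _+ℤ_; _*_ to _*ℤ_)
open import Data.Rational using (ℚ; 0ℚ; 1ℚ; _≤_) renaming (_+_ to _+ℚ_; _*_ to _*ℚ_; -_ to -ℚ_)
open import Data.Product using (Σ; ∃; _×_; _,_; proj₁)
open import Data.Sum using (_⊎_)
open import Data.List using (List; []; _∷_; map)
open import Data.List.Relation.Unary.All using (All)
open import Data.Empty using (⊥-elim)
open import Relation.Nullary using (Dec; yes; no; ¬_)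
open import Relation.Binary.Definitions using (DecidableEquality; tri<; tri≈; tri>)
open import Relation.Binary.PropositionalEquality using (_≡_; _≢_; refl; cong)
open import Function.Bundles using (_⤖_; _⇔_; Bijection)
open import Level using (Level; suc; _⊔_)

-- The finite index set Σ comes
-- with decidable equality (needed to form indicator vectors 1_i).
-- A set R of unordered triples is encoded as the predicate R i j k,
-- "[i,j,k] ∈ R", on ordered triples; in all instances below it is
-- invariant under permuting i j k by construction.
record TernaryRelation : Set₁ where
  field
    Carrier : Set
    _≟_     : DecidableEquality Carrier
    R       : Carrier → Carrier → Carrier → Set

open TernaryRelation

IsIso : (T₁ T₂ : TernaryRelation) → (Carrier T₁ ⤖ Carrier T₂) → Set
IsIso T₁ T₂ φ = ∀ i j k →
  R T₁ i j k ⇔ R T₂ (f i) (f j) (f k)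
  where f = Bijection.to φ

𝟙 : (T : TernaryRelation) → Carrier T → Carrier T → ℚ
𝟙 T i c with _≟_ T i c
... | yes _ = 1ℚ
... | no  _ = 0ℚ

Generator : (T : TernaryRelation) → (Carrier T → ℚ) → Set
Generator T g = Σ (Carrier T) λ i → Σ (Carrier T) λ j → Σ (Carrier T) λ k →
  R T i j k ×
  ( (∀ c → g c ≡ (𝟙 T i c +ℚ 𝟙 T j c) +ℚ (-ℚ 𝟙 T k c))
  ⊎ (∀ c → g c ≡ (𝟙 T i c +ℚ (-ℚ 𝟙 T j c)) +ℚ 𝟙 T k c)
  ⊎ (∀ c → g c ≡ ((-ℚ 𝟙 T i c) +ℚ 𝟙 T j c) +ℚ 𝟙 T k c) )

sumℚ : List ℚ → ℚ
sumℚ [] = 0ℚ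
sumℚ (q ∷ qs) = q +ℚ sumℚ qs

InConv : {C : Set} → ((C → ℚ) → Set) → (C → ℚ) → Set
InConv {C} S x = Σ (List (ℚ × (C → ℚ))) λ L →
  All (λ p → (0ℚ ≤ proj₁ p) × S (Data.Product.proj₂ p)) L ×
  (sumℚ (map proj₁ L) ≡ 1ℚ) ×
  (∀ c → x c ≡ sumℚ (map (λ p → proj₁ p *ℚ Data.Product.proj₂ p c) L))

InP : (T : TernaryRelation) → (Carrier T → ℚ) → Set
InP T = InConv (Generator T)

-- indices of the chosen representatives α of ±α in B_n
data BRoot (n : ℕ) : Set where
  minus : (i j : Fin n) → i < j → BRoot n
  plus  : (i j : Fin n) → i < j → BRoot n
  short : (i : Fin n) → BRoot n

ε : {n : ℕ} → Fin n → Fin n → ℤ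
ε i c with i ≟F c
... | yes _ = + 1
... | no  _ = + 0

root : {n : ℕ} → BRoot n → Fin n → ℤ
root (minus i j _) c = ε i c +ℤ (- ε j c)
root (plus  i j _) c = ε i c +ℤ ε j c
root (short i)     c = ε i c

data Sign : Set where
  pos neg : Sign

act : Sign → ℤ → ℤ
act pos z = z
act neg z = - z

RB : {n : ℕ} → BRoot n → BRoot n → BRoot n → Set
RB a b c = Σ Sign λ s → Σ Sign λ t → Σ Sign λ u →
  ∀ x → (act s (root a x) +ℤ act t (root b x)) +ℤ act u (root c x) ≡ + 0

private
  decPair : {n : ℕ} (i j i' j' : Fin n) (p : i < j) (p' : i' < j') →
            Dec (Σ (i ≡ i') λ _ → j ≡ j')
  decPair i j i' j' p p' with i ≟F i' | j ≟F j'
  ... | yes e | yes f = yes (e , f)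
  ... | no ne | _     = no λ { (e , _) → ne e }
  ... | yes _ | no nf = no λ { (_ , f) → nf f }

_≟B_ : {n : ℕ} → DecidableEquality (BRoot n)
minus i j p ≟B minus i' j' p' with decPair i j i' j' p p'
... | yes (refl , refl) rewrite <-irrelevant p p' = yes refl
... | no ne = no λ { refl → ne (refl , refl) }
plus i j p ≟B plus i' j' p' with decPair i j i' j' p p'
... | yes (refl , refl) rewrite <-irrelevant p p' = yes refl
... | no ne = no λ { refl → ne (refl , refl) }
short i ≟B short i' with i ≟F i'
... | yes refl = yes refl
... | no ne = no λ { refl → ne refl }
minus _ _ _ ≟B plus _ _ _ = no λ ()
minus _ _ _ ≟B short _ = no λ ()
plus _ _ _ ≟B minus _ _ _ = no λ ()
plus _ _ _ ≟B short _ = no λ ()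
short _ ≟B minus _ _ _ = no λ ()
short _ ≟B plus _ _ _ = no λ ()

TB : ℕ → TernaryRelation
TB n = record { Carrier = BRoot n ; _≟_ = _≟B_ ; R = RB }

-- edges; unordered pairs {i,j} are represented by i < j
data Edge (n : ℕ) : Set where
  eL : (i j : Fin n) → i < j → Edge n   -- e_{ij} = e_{ji}
  eU : (i j : Fin n) → i < j → Edge n   -- e^i_j = e^j_i
  e₀ : (i : Fin n) → Edge n             -- e_i  (endpoints v_0, v_i)

eL' : {n : ℕ} (i j : Fin n) → i ≢ j → Edge n
eL' i j ne with <-cmp i j
... | tri< p _ _ = eL i j p
... | tri≈ _ e _ = ⊥-elim (ne e)
... | tri> _ _ p = eL j i p

eU' : {n : ℕ} (i j : Fin n) → i ≢ j → Edge n
eU' i j ne with <-cmp i j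
... | tri< p _ _ = eU i j p
... | tri≈ _ e _ = ⊥-elim (ne e)
... | tri> _ _ p = eU j i p

data Triangle (n : ℕ) : Set where
  -- Δ_{ijk}, {i,j,k} a 3-subset, i < j < k
  Δ₃  : (i j k : Fin n) → i < j → j < k → Triangle n
  -- Δ^i_{jk} = Δ^i_{kj}, i,j,k pairwise distinct (j < k)
  Δᵘ₃ : (i j k : Fin n) → j < k → i ≢ j → i ≢ k → Triangle n
  -- Δ_{ij} = Δ_{ji}
  Δ₂  : (i j : Fin n) → i < j → Triangle n
  -- Δ^i_j = Δ^j_i
  Δᵘ₂ : (i j : Fin n) → i < j → Triangle n

private
  <⇒≢ : {n : ℕ} {i j : Fin n} → i < j → i ≢ j
  <⇒≢ p refl = Data.Nat.Properties.<-irrefl refl p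
    where import Data.Nat.Properties

facets : {n : ℕ} → Triangle n → Edge n × Edge n × Edge n
facets (Δ₃ i j k p q) =
  eL i j p , eL j k q , eL i k (Data.Fin.Properties.<-trans p q)
  where import Data.Fin.Properties
facets (Δᵘ₃ i j k q nij nik) = eU' i j nij , eU' i k nik , eL j k q
facets (Δ₂ i j p)  = e₀ i , eL i j p , e₀ j
facets (Δᵘ₂ i j p) = e₀ i , eU i j p , e₀ j

IsOrderingOf : {A : Set} → A → A → A → A × A × A → Set
IsOrderingOf a b c (x , y , z) =
    (a ≡ x × b ≡ y × c ≡ z) ⊎ (a ≡ x × b ≡ z × c ≡ y)
  ⊎ (a ≡ y × b ≡ x × c ≡ z) ⊎ (a ≡ y × b ≡ z × c ≡ x)
  ⊎ (a ≡ z × b ≡ x × c ≡ y) ⊎ (a ≡ z × b ≡ y × c ≡ x)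

RK : {n : ℕ} → Edge n → Edge n → Edge n → Set
RK e₁ e₂ e₃ = Σ (Triangle _) λ t → IsOrderingOf e₁ e₂ e₃ (facets t)

_≟E_ : {n : ℕ} → DecidableEquality (Edge n)
eL i j p ≟E eL i' j' p' with i ≟F i' | j ≟F j'
... | yes refl | yes refl rewrite <-irrelevant p p' = yes refl
... | no ne | _ = no λ { refl → ne refl }
... | yes _ | no nf = no λ { refl → nf refl }
eU i j p ≟E eU i' j' p' with i ≟F i' | j ≟F j'
... | yes refl | yes refl rewrite <-irrelevant p p' = yes refl
... | no ne | _ = no λ { refl → ne refl }
... | yes _ | no nf = no λ { refl → nf refl }
e₀ i ≟E e₀ i' with i ≟F i'
... | yes refl = yes refl
... | no ne = no λ { refl → ne refl }
eL _ _ _ ≟E eU _ _ _ = no λ ()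
eL _ _ _ ≟E e₀ _ = no λ ()
eU _ _ _ ≟E eL _ _ _ = no λ ()
eU _ _ _ ≟E e₀ _ = no λ ()
e₀ _ ≟E eL _ _ _ = no λ ()
e₀ _ ≟E eU _ _ _ = no λ ()

TK : ℕ → TernaryRelation
TK n = record { Carrier = Edge n ; _≟_ = _≟E_ ; R = RK }

-- Edges and roots correspond via e_{ij} ↦ ε_i − ε_j, e^i_j ↦ ε_i + ε_j and e_i ↦ ε_i,
-- and the three facets of every triangle of (C K̄_n)^(2) satisfy a signed relation.
-- Conversely, let ±α ± β ± γ = 0.  Summing coordinates, the weights of the roots
-- (0 for ε_i − ε_j, 1 for ε_i, 2 for ε_i + ε_j) cancel with the same signs, leaving the shapes
-- {ε_i, ε_j, long root}, three differences, and one difference with two sums.  At a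
-- coordinate in the support of one root the relation forces exactly one of the other
-- two roots to be nonzero, so the supports are {i}, {j}, {i,j} or the sides of a
-- triangle {x,y}, {y,z}, {x,z}; in each case the edges are the facets of a triangle.
-- Finally, an isomorphism of ternary relations maps the generators of one ternary
-- polytope onto those of the other, so it identifies the polytopes.
module Submission where

open import Defs
open import Data.Nat using (ℕ; _≤_)
import Data.Nat as ℕ
open import Data.Rational using (ℚ)
open import Data.Product using (Σ; _×_)
open import Function.Base using (_∘_)
open import Function.Bundles using (_⤖_; _⇔_; Bijection)

open import Data.Bool using (Bool; T)
open import Data.Bool.ListAction using (any)
open import Data.Empty using (⊥-elim)
open import Data.Fin using (Fin; zero; suc; _<_)
open import Data.Fin.Properties using (<-cmp; <-irrelevant; <-asym; <⇒≢) renaming (_≟_ to _≟F_)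
open import Data.Integer using (ℤ; +_; -_; 0ℤ; 1ℤ; -1ℤ; _+_; _*_)
open import Data.Integer.Properties
  using (+-*-semiring; +-comm; +-identityˡ; +-identityʳ; -1*i≡-i) renaming (_≟_ to _≟ℤ_)
open import Algebra.Properties.Semiring.Sum +-*-semiring
  using (sum; sum-cong-≗; ∑-distrib-+; sum-replicate-zero; *-distribˡ-sum)
open import Data.Integer.Tactic.RingSolver using (solve-∀)
open import Data.List using (List; []; _∷_; map; cartesianProduct)
open import Data.List.Membership.Propositional using (_∈_)
open import Data.List.Membership.Propositional.Properties using (∈-cartesianProduct⁺)
open import Data.List.Properties using (map-∘)
import Data.List.Relation.Unary.All as All
open import Data.List.Relation.Unary.All.Properties using (map⁺)
open import Data.List.Relation.Unary.Any using (here; there)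
import Data.List.Relation.Unary.Any as Any
open import Data.List.Relation.Unary.Any.Properties using (any⁺)
open import Data.Product using (∃-syntax; _,_; proj₁; proj₂)
import Data.Product as Product
open import Data.Rational using () renaming (_+_ to _+ℚ_; -_ to -ℚ_)
open import Data.Sum using (_⊎_; inj₁; inj₂; [_,_]′)
import Data.Sum as Sum
open import Function.Base using (id)
open import Function.Bundles using (_↔_; Inverse; mk⇔; mk↔ₛ′; module Equivalence)
open import Function.Properties.Bijection using (⤖⇒↔)
open import Function.Properties.Inverse using (↔-sym; ↔⇒⤖)
open import Relation.Binary.Definitions using (tri<; tri≈; tri>)
open import Relation.Binary.PropositionalEquality
open import Relation.Nullary using (¬_; Dec; yes; no)
open import Relation.Nullary.Decidable using (⌊_⌋; fromWitness; _⊎-dec_)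

open TernaryRelation

-- The six disjuncts of IsOrderingOf a b c (x , y , z), named by the order in which
-- a, b, c list x, y, z.
pattern xyz e = inj₁ e
pattern xzy e = inj₂ (inj₁ e)
pattern yxz e = inj₂ (inj₂ (inj₁ e))
pattern yzx e = inj₂ (inj₂ (inj₂ (inj₁ e)))
pattern zxy e = inj₂ (inj₂ (inj₂ (inj₂ (inj₁ e))))
pattern zyx e = inj₂ (inj₂ (inj₂ (inj₂ (inj₂ e))))
pattern refl³ = refl , refl , refl

module _ {A : Set} where

  ordering-swap₁₂ : ∀ {a b c : A} {T} → IsOrderingOf a b c T → IsOrderingOf b a c T
  ordering-swap₁₂ (xyz refl³) = yxz refl³
  ordering-swap₁₂ (xzy refl³) = zxy refl³
  ordering-swap₁₂ (yxz refl³) = xyz refl³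
  ordering-swap₁₂ (yzx refl³) = zyx refl³
  ordering-swap₁₂ (zxy refl³) = xzy refl³
  ordering-swap₁₂ (zyx refl³) = yzx refl³

  ordering-swap₂₃ : ∀ {a b c : A} {T} → IsOrderingOf a b c T → IsOrderingOf a c b T
  ordering-swap₂₃ (xyz refl³) = xzy refl³
  ordering-swap₂₃ (xzy refl³) = xyz refl³
  ordering-swap₂₃ (yxz refl³) = yzx refl³
  ordering-swap₂₃ (yzx refl³) = yxz refl³
  ordering-swap₂₃ (zxy refl³) = zyx refl³
  ordering-swap₂₃ (zyx refl³) = zxy refl³

module _ {A : Set} (P : A → A → A → Set)
         (swap₁₂ : ∀ {a b c} → P a b c → P b a c)
         (swap₂₃ : ∀ {a b c} → P a b c → P a c b) where

  reorder : ∀ {a b c x y z} → IsOrderingOf a b c (x , y , z) → P x y z → P a b c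
  reorder (xyz refl³) = id
  reorder (xzy refl³) = swap₂₃
  reorder (yxz refl³) = swap₁₂
  reorder (yzx refl³) = swap₂₃ ∘ swap₁₂
  reorder (zxy refl³) = swap₁₂ ∘ swap₂₃
  reorder (zyx refl³) = swap₁₂ ∘ swap₂₃ ∘ swap₁₂

OneOf : Set → Set → Set
OneOf A B = (A × ¬ B) ⊎ (¬ A × B)

module _ {V : Set} where

  _∈₂_ : V → V × V → Set
  x ∈₂ P = x ≡ proj₁ P ⊎ x ≡ proj₂ P

  _≐_ : V × V → V × V → Set
  P ≐ Q = (proj₁ P ≡ proj₁ Q × proj₂ P ≡ proj₂ Q) ⊎ (proj₁ P ≡ proj₂ Q × proj₂ P ≡ proj₁ Q)

  Distinct : V × V → Set
  Distinct P = proj₁ P ≢ proj₂ P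

  record Covering (A B C : V → Set) : Set where
    field
      cover₁ : ∀ {x} → A x → OneOf (B x) (C x)
      cover₂ : ∀ {x} → B x → OneOf (A x) (C x)
      cover₃ : ∀ {x} → C x → OneOf (A x) (B x)

  open Covering

  IsTriangle : V × V → V × V → V × V → Set
  IsTriangle P Q R = ∃[ x ] ∃[ y ] ∃[ z ] P ≐ (x , y) × Q ≐ (y , z) × R ≐ (x , z)

  ≐-sym : ∀ {P Q} → P ≐ Q → Q ≐ P
  ≐-sym (inj₁ (refl , refl)) = inj₁ (refl , refl)
  ≐-sym (inj₂ (refl , refl)) = inj₂ (refl , refl)

  ≐-flipʳ : ∀ {P x y} → P ≐ (x , y) → P ≐ (y , x)
  ≐-flipʳ = Sum.swap

  ≐-∈ : ∀ {P Q x} → P ≐ Q → x ∈₂ P → x ∈₂ Q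
  ≐-∈ (inj₁ (refl , refl)) = id
  ≐-∈ (inj₂ (refl , refl)) = Sum.swap

  ≐-distinct : ∀ {P Q} → P ≐ Q → Distinct P → Distinct Q
  ≐-distinct (inj₁ (refl , refl)) P≢ = P≢
  ≐-distinct (inj₂ (refl , refl)) P≢ = P≢ ∘ sym

  ∈₂-other : ∀ {P x} → x ∈₂ P → ∃[ y ] P ≐ (x , y)
  ∈₂-other (inj₁ refl) = _ , inj₁ (refl , refl)
  ∈₂-other (inj₂ refl) = _ , inj₂ (refl , refl)

  ≐-of-members : ∀ {P x y} → x ∈₂ P → y ∈₂ P → x ≢ y → P ≐ (x , y)
  ≐-of-members (inj₁ refl) (inj₁ refl) x≢y = ⊥-elim (x≢y refl)
  ≐-of-members (inj₁ refl) (inj₂ refl) x≢y = inj₁ (refl , refl)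
  ≐-of-members (inj₂ refl) (inj₁ refl) x≢y = inj₂ (refl , refl)
  ≐-of-members (inj₂ refl) (inj₂ refl) x≢y = ⊥-elim (x≢y refl)

  ≐⇒¬OneOf : ∀ {P Q x} → Q ≐ P → ¬ OneOf (x ∈₂ P) (x ∈₂ Q)
  ≐⇒¬OneOf Q≐P (inj₁ (x∈P , x∉Q)) = x∉Q (≐-∈ (≐-sym Q≐P) x∈P)
  ≐⇒¬OneOf Q≐P (inj₂ (x∉P , x∈Q)) = x∉P (≐-∈ Q≐P x∈Q)

  third-vertex : ∀ {i j S T} → Distinct S → i ∈₂ S → ¬ j ∈₂ S →
                 (∀ {y} → y ∈₂ S → OneOf (y ∈₂ (i , j)) (y ∈₂ T)) → j ∈₂ T →
                 ∃[ y ] S ≐ (i , y) × T ≐ (j , y)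
  third-vertex {i} {j} {S} {T} S≢ i∈S j∉S cover j∈T with ∈₂-other i∈S
  ... | y , S≐iy = y , S≐iy , ≐-of-members j∈T y∈T (y≢j ∘ sym)
    where
      y∈S : y ∈₂ S
      y∈S = ≐-∈ (≐-sym S≐iy) (inj₂ refl)
      y≢j : y ≢ j
      y≢j refl = j∉S y∈S
      y∈T : y ∈₂ T
      y∈T = Sum.[ (λ (y∈ij , _) → ⊥-elim ([ ≐-distinct S≐iy S≢ ∘ sym , y≢j ]′ y∈ij)) , proj₂ ]′ (cover y∈S)

  covering⇒triangle : ∀ {P Q R} → Distinct P → Distinct Q → Distinct R →
                      Covering (_∈₂ P) (_∈₂ Q) (_∈₂ R) → IsTriangle P Q R
  covering⇒triangle P≢ Q≢ R≢ cov with cover₁ cov (inj₁ refl) | cover₁ cov (inj₂ refl)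
  -- If both ends of P lie on one side, that side equals P, and the ends of the
  -- remaining side cannot lie in exactly one of two equal pairs.
  ... | inj₁ (i∈Q , _) | inj₁ (j∈Q , _) = ⊥-elim (≐⇒¬OneOf (≐-of-members i∈Q j∈Q P≢) (cover₃ cov (inj₁ refl)))
  ... | inj₂ (_ , i∈R) | inj₂ (_ , j∈R) = ⊥-elim (≐⇒¬OneOf (≐-of-members i∈R j∈R P≢) (cover₂ cov (inj₁ refl)))
  ... | inj₁ (i∈Q , _) | inj₂ (j∉Q , j∈R) with third-vertex Q≢ i∈Q j∉Q (cover₂ cov) j∈R
  ...   | y , Q≐iy , R≐jy = _ , _ , y , inj₂ (refl , refl) , Q≐iy , R≐jy
  covering⇒triangle P≢ Q≢ R≢ cov | inj₂ (_ , i∈R) | inj₁ (j∈Q , j∉R) with third-vertex R≢ i∈R j∉R (cover₃ cov) j∈Q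
  ...   | y , R≐iy , Q≐jy = _ , _ , y , inj₁ (refl , refl) , Q≐jy , R≐iy

  singletons-covering⇒≐ : ∀ {i j P} → Distinct P → Covering (_≡ i) (_≡ j) (_∈₂ P) → (i , j) ≐ P
  singletons-covering⇒≐ P≢ cov with cover₃ cov (inj₁ refl) | cover₃ cov (inj₂ refl)
  ... | inj₁ (k≡i , _)  | inj₁ (l≡i , _)  = ⊥-elim (P≢ (trans k≡i (sym l≡i)))
  ... | inj₁ (refl , _) | inj₂ (_ , refl) = inj₁ (refl , refl)
  ... | inj₂ (_ , refl) | inj₁ (refl , _) = inj₂ (refl , refl)
  ... | inj₂ (_ , k≡j)  | inj₂ (_ , l≡j)  = ⊥-elim (P≢ (trans k≡j (sym l≡j)))

module _ {C₁ C₂ : Set} {S₁ : (C₁ → ℚ) → Set} {S₂ : (C₂ → ℚ) → Set} where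

  InConv-pullback : (τ : C₂ → C₁) → (∀ {g} → S₁ g → S₂ (g ∘ τ)) →
                    ∀ {x} → InConv S₁ x → InConv S₂ (x ∘ τ)
  InConv-pullback τ pull (L , weights , total , x≡ΣL) =
    map (Product.map₂ (_∘ τ)) L ,
    map⁺ (All.map (Product.map₂ pull) weights) ,
    trans (cong sumℚ (sym (map-∘ L))) total ,
    λ c → trans (x≡ΣL (τ c)) (cong sumℚ (map-∘ L))

InConv-resp-≗ : ∀ {C} {S : (C → ℚ) → Set} {x y : C → ℚ} → (∀ c → x c ≡ y c) → InConv S x → InConv S y
InConv-resp-≗ x≗y (L , weights , total , x≡ΣL) = L , weights , total , λ c → trans (sym (x≗y c)) (x≡ΣL c)

R-resp : ∀ (T : TernaryRelation) {i i′ j j′ k k′} → i′ ≡ i → j′ ≡ j → k′ ≡ k → R T i j k → R T i′ j′ k′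
R-resp T refl refl refl = id

module _ (T₁ T₂ : TernaryRelation) (f : Carrier T₁ ↔ Carrier T₂) where
  open Inverse f

  𝟙-pullback : ∀ i c → 𝟙 T₂ i (to c) ≡ 𝟙 T₁ (from i) c
  𝟙-pullback i c with _≟_ T₂ i (to c) | _≟_ T₁ (from i) c
  ... | yes _    | yes _    = refl
  ... | no _     | no _     = refl
  ... | yes i≡tc | no fi≢c  = ⊥-elim (fi≢c (trans (cong from i≡tc) (strictlyInverseʳ c)))
  ... | no i≢tc  | yes fi≡c = ⊥-elim (i≢tc (trans (sym (strictlyInverseˡ i)) (cong to fi≡c)))

  Generator-pullback : (∀ {i j k} → R T₂ i j k → R T₁ (from i) (from j) (from k)) →
                       ∀ {g} → Generator T₂ g → Generator T₁ (g ∘ to)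
  Generator-pullback reflect {g} (i , j , k , r , shape) =
    from i , from j , from k , reflect r ,
    Sum.map (pull (λ a b d → (a +ℚ b) +ℚ (-ℚ d)))
      (Sum.map (pull (λ a b d → (a +ℚ (-ℚ b)) +ℚ d)) (pull (λ a b d → ((-ℚ a) +ℚ b) +ℚ d))) shape
    where
      pull : (F : ℚ → ℚ → ℚ → ℚ) →
             (∀ c → g c ≡ F (𝟙 T₂ i c) (𝟙 T₂ j c) (𝟙 T₂ k c)) →
             ∀ c → g (to c) ≡ F (𝟙 T₁ (from i) c) (𝟙 T₁ (from j) c) (𝟙 T₁ (from k) c)
      pull F g≡F c rewrite sym (𝟙-pullback i c) | sym (𝟙-pullback j c) | sym (𝟙-pullback k c) = g≡F (to c)

InP-iso : ∀ T₁ T₂ (φ : Carrier T₁ ⤖ Carrier T₂) → IsIso T₁ T₂ φ →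
          ∀ x → InP T₂ x ⇔ InP T₁ (x ∘ Bijection.to φ)
InP-iso T₁ T₂ φ iso x = mk⇔
  (InConv-pullback to (Generator-pullback T₁ T₂ f reflect))
  (InConv-resp-≗ (cong x ∘ strictlyInverseˡ) ∘ InConv-pullback from (Generator-pullback T₂ T₁ (↔-sym f) preserve))
  where
    f : Carrier T₁ ↔ Carrier T₂
    f = ⤖⇒↔ φ
    open Inverse f
    preserve : ∀ {i j k} → R T₁ i j k → R T₂ (to i) (to j) (to k)
    preserve = Equivalence.to (iso _ _ _)
    reflect : ∀ {i j k} → R T₂ i j k → R T₁ (from i) (from j) (from k)
    reflect {i} {j} {k} = Equivalence.from (iso (from i) (from j) (from k))
                        ∘ R-resp T₂ (strictlyInverseˡ i) (strictlyInverseˡ j) (strictlyInverseˡ k)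

data IsUnit : ℤ → Set where
  unit⁺ : IsUnit 1ℤ
  unit⁻ : IsUnit -1ℤ

act-unit : ∀ s {α} → IsUnit α → IsUnit (act s α)
act-unit pos u     = u
act-unit neg unit⁺ = unit⁻
act-unit neg unit⁻ = unit⁺

act-zero : ∀ s → act s 0ℤ ≡ 0ℤ
act-zero pos = refl
act-zero neg = refl

unit≢0 : ∀ {α} → IsUnit α → α ≢ 0ℤ
unit≢0 unit⁺ ()
unit≢0 unit⁻ ()

units-sum≢0 : ∀ {α β γ} → IsUnit α → IsUnit β → IsUnit γ → (α + β) + γ ≢ 0ℤ
units-sum≢0 unit⁺ unit⁺ unit⁺ ()
units-sum≢0 unit⁺ unit⁺ unit⁻ ()
units-sum≢0 unit⁺ unit⁻ unit⁺ ()
units-sum≢0 unit⁺ unit⁻ unit⁻ ()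
units-sum≢0 unit⁻ unit⁺ unit⁺ ()
units-sum≢0 unit⁻ unit⁺ unit⁻ ()
units-sum≢0 unit⁻ unit⁻ unit⁺ ()
units-sum≢0 unit⁻ unit⁻ unit⁻ ()

module _ {n : ℕ} where

  ε-diag : (i : Fin n) → ε i i ≡ 1ℤ
  ε-diag i with i ≟F i
  ... | yes _   = refl
  ... | no i≢i = ⊥-elim (i≢i refl)

  ε-off : {i x : Fin n} → i ≢ x → ε i x ≡ 0ℤ
  ε-off {i} {x} i≢x with i ≟F x
  ... | yes i≡x = ⊥-elim (i≢x i≡x)
  ... | no _    = refl

  _∈ᵣ_ : Fin n → BRoot n → Set
  x ∈ᵣ short i     = x ≡ i
  x ∈ᵣ minus i j _ = x ∈₂ (i , j)
  x ∈ᵣ plus  i j _ = x ∈₂ (i , j)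

  _∈ᵣ?_ : ∀ x a → Dec (x ∈ᵣ a)
  x ∈ᵣ? short i     = x ≟F i
  x ∈ᵣ? minus i j _ = (x ≟F i) ⊎-dec (x ≟F j)
  x ∈ᵣ? plus  i j _ = (x ≟F i) ⊎-dec (x ≟F j)

  root-unit : ∀ {x} (a : BRoot n) → x ∈ᵣ a → IsUnit (root a x)
  root-unit (short i)       refl        rewrite ε-diag i                         = unit⁺
  root-unit (minus i j i<j) (inj₁ refl) rewrite ε-diag i | ε-off (<⇒≢ i<j ∘ sym) = unit⁺
  root-unit (minus i j i<j) (inj₂ refl) rewrite ε-diag j | ε-off (<⇒≢ i<j)       = unit⁻
  root-unit (plus i j i<j)  (inj₁ refl) rewrite ε-diag i | ε-off (<⇒≢ i<j ∘ sym) = unit⁺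
  root-unit (plus i j i<j)  (inj₂ refl) rewrite ε-diag j | ε-off (<⇒≢ i<j)       = unit⁺

  root-zero : ∀ {x} (a : BRoot n) → ¬ x ∈ᵣ a → root a x ≡ 0ℤ
  root-zero (short i)     x∉a = ε-off (x∉a ∘ sym)
  root-zero (minus i j _) x∉a rewrite ε-off (x∉a ∘ inj₁ ∘ sym) | ε-off (x∉a ∘ inj₂ ∘ sym) = refl
  root-zero (plus i j _)  x∉a rewrite ε-off (x∉a ∘ inj₁ ∘ sym) | ε-off (x∉a ∘ inj₂ ∘ sym) = refl

  RB-swap₁₂ : ∀ (a b c : BRoot n) → RB a b c → RB b a c
  RB-swap₁₂ a b c (s , t , u , eq) = t , s , u , λ x →
    trans (cong (_+ act u (root c x)) (+-comm (act t (root b x)) (act s (root a x)))) (eq x)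

  RB-swap₂₃ : ∀ (a b c : BRoot n) → RB a b c → RB a c b
  RB-swap₂₃ a b c (s , t , u , eq) = s , u , t , λ x →
    trans (swap-last (act s (root a x)) (act u (root c x)) (act t (root b x))) (eq x)
    where
      swap-last : ∀ α β γ → (α + β) + γ ≡ (α + γ) + β
      swap-last = solve-∀

  one-other-root : ∀ (a b c : BRoot n) → RB a b c → ∀ {x} → x ∈ᵣ a → OneOf (x ∈ᵣ b) (x ∈ᵣ c)
  one-other-root a b c (s , t , u , eq) {x} x∈a with x ∈ᵣ? b | x ∈ᵣ? c
  ... | yes x∈b | no x∉c  = inj₁ (x∈b , x∉c)
  ... | no x∉b  | yes x∈c = inj₂ (x∉b , x∈c)
  ... | yes x∈b | yes x∈c = ⊥-elim (units-sum≢0 (signed s a x∈a) (signed t b x∈b) (signed u c x∈c) (eq x))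
    where
      signed : ∀ s d → x ∈ᵣ d → IsUnit (act s (root d x))
      signed s d x∈d = act-unit s (root-unit d x∈d)
  ... | no x∉b  | no x∉c  = ⊥-elim (unit≢0 (act-unit s (root-unit a x∈a)) (begin
    act s (root a x)                                          ≡⟨ +-identityʳ _ ⟨
    act s (root a x) + 0ℤ                                     ≡⟨ +-identityʳ _ ⟨
    (act s (root a x) + 0ℤ) + 0ℤ                              ≡⟨ cong₂ (λ β γ → (act s (root a x) + β) + γ)
                                                                        (vanishes t b x∉b) (vanishes u c x∉c) ⟨
    (act s (root a x) + act t (root b x)) + act u (root c x)  ≡⟨ eq x ⟩
    0ℤ                                                        ∎))
    where
      open ≡-Reasoning
      vanishes : ∀ s d → ¬ x ∈ᵣ d → act s (root d x) ≡ 0ℤ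
      vanishes s d x∉d = trans (cong (act s) (root-zero d x∉d)) (act-zero s)

  RB⇒covering : ∀ (a b c : BRoot n) → RB a b c → Covering (_∈ᵣ a) (_∈ᵣ b) (_∈ᵣ c)
  RB⇒covering a b c ρ = record
    { cover₁ = one-other-root a b c ρ
    ; cover₂ = one-other-root b a c (RB-swap₁₂ a b c ρ)
    ; cover₃ = one-other-root c a b (RB-swap₁₂ a c b (RB-swap₂₃ a b c ρ))
    }

sum-neg : ∀ {n} (f : Fin n → ℤ) → sum (-_ ∘ f) ≡ - sum f
sum-neg f = begin
  sum (-_ ∘ f)            ≡⟨ sum-cong-≗ (sym ∘ -1*i≡-i ∘ f) ⟩
  sum (λ x → -1ℤ * f x)   ≡⟨ *-distribˡ-sum -1ℤ f ⟨
  -1ℤ * sum f             ≡⟨ -1*i≡-i (sum f) ⟩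
  - sum f                 ∎
  where open ≡-Reasoning

sum-act : ∀ {n} s (f : Fin n → ℤ) → sum (act s ∘ f) ≡ act s (sum f)
sum-act pos f = refl
sum-act neg f = sum-neg f

ε-suc : ∀ {n} (i x : Fin n) → ε (suc i) (suc x) ≡ ε i x
ε-suc i x with i ≟F x
... | yes _ = refl
... | no _  = refl

sum-ε : ∀ {n} (i : Fin n) → sum (ε i) ≡ 1ℤ
sum-ε {ℕ.suc n} zero    = cong (_+_ 1ℤ) (sum-replicate-zero n)
sum-ε {ℕ.suc n} (suc i) = trans (+-identityˡ _) (trans (sum-cong-≗ (ε-suc i)) (sum-ε i))

weight : ∀ {n} → BRoot n → ℤ
weight (minus _ _ _) = 0ℤ
weight (plus _ _ _)  = + 2
weight (short _)     = 1ℤ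

sum-root : ∀ {n} (a : BRoot n) → sum (root a) ≡ weight a
sum-root (minus i j _) = begin
  sum (λ x → ε i x + - ε j x)  ≡⟨ ∑-distrib-+ (ε i) (-_ ∘ ε j) ⟩
  sum (ε i) + sum (-_ ∘ ε j)   ≡⟨ cong₂ _+_ (sum-ε i) (trans (sum-neg (ε j)) (cong -_ (sum-ε j))) ⟩
  0ℤ                           ∎
  where open ≡-Reasoning
sum-root (plus i j _) = trans (∑-distrib-+ (ε i) (ε j)) (cong₂ _+_ (sum-ε i) (sum-ε j))
sum-root (short i)    = sum-ε i

signs : List Sign
signs = pos ∷ neg ∷ []

sign∈signs : ∀ s → s ∈ signs
sign∈signs pos = here refl
sign∈signs neg = there (here refl)

vanishes-with : ℤ → ℤ → ℤ → Sign × Sign × Sign → Bool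
vanishes-with α β γ (s , t , u) = ⌊ (act s α + act t β) + act u γ ≟ℤ 0ℤ ⌋

-- A boolean rather than a proposition, so that on the weights of concrete roots it
-- evaluates, and an impossible shape yields T false, i.e. ⊥.
balanced : ℤ → ℤ → ℤ → Bool
balanced α β γ = any (vanishes-with α β γ) (cartesianProduct signs (cartesianProduct signs signs))

balanced-intro : ∀ α β γ s t u → (act s α + act t β) + act u γ ≡ 0ℤ → T (balanced α β γ)
balanced-intro α β γ s t u eq = any⁺ (vanishes-with α β γ)
  (Any.map (λ { refl → fromWitness {a? = (act s α + act t β) + act u γ ≟ℤ 0ℤ} eq })
    (∈-cartesianProduct⁺ (sign∈signs s) (∈-cartesianProduct⁺ (sign∈signs t) (sign∈signs u))))

weights-balanced : ∀ {n} (a b c : BRoot n) → RB a b c → T (balanced (weight a) (weight b) (weight c))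
weights-balanced {n} a b c (s , t , u , eq) = balanced-intro (weight a) (weight b) (weight c) s t u (begin
  (act s (weight a) + act t (weight b)) + act u (weight c)
    ≡⟨ cong₂ _+_ (cong₂ _+_ (summed s a) (summed t b)) (summed u c) ⟨
  (sum (act s ∘ root a) + sum (act t ∘ root b)) + sum (act u ∘ root c)
    ≡⟨ cong (_+ sum (act u ∘ root c)) (∑-distrib-+ (act s ∘ root a) (act t ∘ root b)) ⟨
  sum (λ x → act s (root a x) + act t (root b x)) + sum (act u ∘ root c)
    ≡⟨ ∑-distrib-+ (λ x → act s (root a x) + act t (root b x)) (act u ∘ root c) ⟨
  sum (λ x → (act s (root a x) + act t (root b x)) + act u (root c x))
    ≡⟨ sum-cong-≗ eq ⟩
  sum {n} (λ _ → 0ℤ)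
    ≡⟨ sum-replicate-zero n ⟩
  0ℤ ∎)
  where
    open ≡-Reasoning
    summed : ∀ s d → sum (act s ∘ root d) ≡ act s (weight d)
    summed s d = trans (sum-act s (root d)) (cong (act s) (sum-root d))

module _ {n : ℕ} where

  toRoot : Edge n → BRoot n
  toRoot (eL i j i<j) = minus i j i<j
  toRoot (eU i j i<j) = plus i j i<j
  toRoot (e₀ i)       = short i

  toEdge : BRoot n → Edge n
  toEdge (minus i j i<j) = eL i j i<j
  toEdge (plus i j i<j)  = eU i j i<j
  toEdge (short i)       = e₀ i

  edge↔root : Edge n ↔ BRoot n
  edge↔root = mk↔ₛ′ toRoot toEdge toRoot∘toEdge toEdge∘toRoot
    where
      toRoot∘toEdge : ∀ a → toRoot (toEdge a) ≡ a
      toRoot∘toEdge (minus _ _ _) = refl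
      toRoot∘toEdge (plus _ _ _)  = refl
      toRoot∘toEdge (short _)     = refl
      toEdge∘toRoot : ∀ e → toEdge (toRoot e) ≡ e
      toEdge∘toRoot (eL _ _ _) = refl
      toEdge∘toRoot (eU _ _ _) = refl
      toEdge∘toRoot (e₀ _)     = refl

  Related : Edge n → Edge n → Edge n → Set
  Related a b c = RB (toRoot a) (toRoot b) (toRoot c)

  Related-swap₁₂ : ∀ a b c → Related a b c → Related b a c
  Related-swap₁₂ a b c = RB-swap₁₂ (toRoot a) (toRoot b) (toRoot c)

  Related-swap₂₃ : ∀ a b c → Related a b c → Related a c b
  Related-swap₂₃ a b c = RB-swap₂₃ (toRoot a) (toRoot b) (toRoot c)

  Related⇒balanced : ∀ a b c → Related a b c →
                     T (balanced (weight (toRoot a)) (weight (toRoot b)) (weight (toRoot c)))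
  Related⇒balanced a b c = weights-balanced (toRoot a) (toRoot b) (toRoot c)

  RK-swap₁₂ : ∀ {a b c : Edge n} → RK a b c → RK b a c
  RK-swap₁₂ (t , o) = t , ordering-swap₁₂ o

  RK-swap₂₃ : ∀ {a b c : Edge n} → RK a b c → RK a c b
  RK-swap₂₃ (t , o) = t , ordering-swap₂₃ o

  root-eU′ : ∀ i j (i≢j : i ≢ j) x → root (toRoot (eU' i j i≢j)) x ≡ ε i x + ε j x
  root-eU′ i j i≢j x with <-cmp i j
  ... | tri< _ _ _   = refl
  ... | tri≈ _ i≡j _ = ⊥-elim (i≢j i≡j)
  ... | tri> _ _ _   = +-comm (ε j x) (ε i x)

  facets-related : (t : Triangle n) →
                   Related (proj₁ (facets t)) (proj₁ (proj₂ (facets t))) (proj₂ (proj₂ (facets t)))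
  facets-related (Δ₃ i j k _ _) = pos , pos , neg , λ x → cycle (ε i x) (ε j x) (ε k x)
    where
      cycle : ∀ α β γ → ((α + - β) + (β + - γ)) + - (α + - γ) ≡ 0ℤ
      cycle = solve-∀
  facets-related (Δᵘ₃ i j k _ i≢j i≢k) = pos , neg , neg , λ x →
    trans (cong₂ (λ α β → (α + - β) + - (ε j x + - ε k x)) (root-eU′ i j i≢j x) (root-eU′ i k i≢k x))
          (apex (ε i x) (ε j x) (ε k x))
    where
      apex : ∀ α β γ → ((α + β) + - (α + γ)) + - (β + - γ) ≡ 0ℤ
      apex = solve-∀
  facets-related (Δ₂ i j _) = pos , neg , neg , λ x → cone (ε i x) (ε j x)
    where
      cone : ∀ α β → (α + - (α + - β)) + - β ≡ 0ℤ
      cone = solve-∀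
  facets-related (Δᵘ₂ i j _) = pos , neg , pos , λ x → cone (ε i x) (ε j x)
    where
      cone : ∀ α β → (α + - (α + β)) + β ≡ 0ℤ
      cone = solve-∀

  RK⇒Related : ∀ {a b c} → RK a b c → Related a b c
  RK⇒Related (t , o) =
    reorder Related (λ {a b c} → Related-swap₁₂ a b c) (λ {a b c} → Related-swap₂₃ a b c) o (facets-related t)

  eL-≐ : ∀ {i j k l : Fin n} (i<j : i < j) (k<l : k < l) → (i , j) ≐ (k , l) → eL i j i<j ≡ eL k l k<l
  eL-≐ i<j k<l (inj₁ (refl , refl)) = cong (eL _ _) (<-irrelevant i<j k<l)
  eL-≐ i<j k<l (inj₂ (refl , refl)) = ⊥-elim (<-asym i<j k<l)

  eU-≐ : ∀ {i j k l : Fin n} (i<j : i < j) (k<l : k < l) → (i , j) ≐ (k , l) → eU i j i<j ≡ eU k l k<l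
  eU-≐ i<j k<l (inj₁ (refl , refl)) = cong (eU _ _) (<-irrelevant i<j k<l)
  eU-≐ i<j k<l (inj₂ (refl , refl)) = ⊥-elim (<-asym i<j k<l)

  eU-≐-eU′ : ∀ {i j x y : Fin n} (i<j : i < j) (x≢y : x ≢ y) → (i , j) ≐ (x , y) → eU i j i<j ≡ eU' x y x≢y
  eU-≐-eU′ {x = x} {y} i<j x≢y ij≐xy with <-cmp x y
  ... | tri< x<y _ _ = eU-≐ i<j x<y ij≐xy
  ... | tri≈ _ x≡y _ = ⊥-elim (x≢y x≡y)
  ... | tri> _ _ y<x = eU-≐ i<j y<x (≐-flipʳ ij≐xy)

  RK-Δ₂ : ∀ {i j k l : Fin n} {k<l : k < l} → (i , j) ≐ (k , l) → RK (e₀ i) (e₀ j) (eL k l k<l)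
  RK-Δ₂ {k<l = k<l} (inj₁ (refl , refl)) = Δ₂ _ _ k<l , xzy refl³
  RK-Δ₂ {k<l = k<l} (inj₂ (refl , refl)) = Δ₂ _ _ k<l , zxy refl³

  RK-Δᵘ₂ : ∀ {i j k l : Fin n} {k<l : k < l} → (i , j) ≐ (k , l) → RK (e₀ i) (e₀ j) (eU k l k<l)
  RK-Δᵘ₂ {k<l = k<l} (inj₁ (refl , refl)) = Δᵘ₂ _ _ k<l , xzy refl³
  RK-Δᵘ₂ {k<l = k<l} (inj₂ (refl , refl)) = Δᵘ₂ _ _ k<l , zxy refl³

  RK-Δ₃ : ∀ {i j k l m r : Fin n} {i<j : i < j} {k<l : k < l} {m<r : m < r} →
          IsTriangle (i , j) (k , l) (m , r) → RK (eL i j i<j) (eL k l k<l) (eL m r m<r)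
  RK-Δ₃ {i<j = i<j} {k<l} {m<r} (x , y , z , P , Q , R) with <-cmp x y
  ... | tri≈ _ x≡y _ = ⊥-elim (≐-distinct P (<⇒≢ i<j) x≡y)
  ... | tri< x<y _ _ with <-cmp y z
  ...   | tri< y<z _ _ = Δ₃ x y z x<y y<z , xyz (eL-≐ i<j x<y P , eL-≐ k<l y<z Q , eL-≐ m<r _ R)
  ...   | tri≈ _ y≡z _ = ⊥-elim (≐-distinct Q (<⇒≢ k<l) y≡z)
  ...   | tri> _ _ z<y with <-cmp x z
  ...     | tri< x<z _ _ = Δ₃ x z y x<z z<y ,
            zyx (eL-≐ i<j _ P , eL-≐ k<l z<y (≐-flipʳ Q) , eL-≐ m<r x<z R)
  ...     | tri≈ _ x≡z _ = ⊥-elim (≐-distinct R (<⇒≢ m<r) x≡z)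
  ...     | tri> _ _ z<x = Δ₃ z x y z<x x<y ,
            yzx (eL-≐ i<j x<y P , eL-≐ k<l _ (≐-flipʳ Q) , eL-≐ m<r z<x (≐-flipʳ R))
  RK-Δ₃ {i<j = i<j} {k<l} {m<r} (x , y , z , P , Q , R) | tri> _ _ y<x with <-cmp x z
  ...   | tri< x<z _ _ = Δ₃ y x z y<x x<z ,
          xzy (eL-≐ i<j y<x (≐-flipʳ P) , eL-≐ k<l _ Q , eL-≐ m<r x<z R)
  ...   | tri≈ _ x≡z _ = ⊥-elim (≐-distinct R (<⇒≢ m<r) x≡z)
  ...   | tri> _ _ z<x with <-cmp y z
  ...     | tri< y<z _ _ = Δ₃ y z x y<z z<x ,
            zxy (eL-≐ i<j _ (≐-flipʳ P) , eL-≐ k<l y<z Q , eL-≐ m<r z<x (≐-flipʳ R))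
  ...     | tri≈ _ y≡z _ = ⊥-elim (≐-distinct Q (<⇒≢ k<l) y≡z)
  ...     | tri> _ _ z<y = Δ₃ z y x z<y y<x ,
            yxz (eL-≐ i<j y<x (≐-flipʳ P) , eL-≐ k<l z<y (≐-flipʳ Q) , eL-≐ m<r _ (≐-flipʳ R))

  RK-Δᵘ₃ : ∀ {i j k l m r : Fin n} {i<j : i < j} {k<l : k < l} {m<r : m < r} →
           IsTriangle (i , j) (k , l) (m , r) → RK (eL i j i<j) (eU k l k<l) (eU m r m<r)
  RK-Δᵘ₃ {i<j = i<j} {k<l} {m<r} (x , y , z , P , Q , R) with <-cmp x y
  ... | tri< x<y _ _ = Δᵘ₃ z x y x<y (≐-distinct R (<⇒≢ m<r) ∘ sym) (≐-distinct Q (<⇒≢ k<l) ∘ sym) ,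
        zyx (eL-≐ i<j x<y P , eU-≐-eU′ k<l _ (≐-flipʳ Q) , eU-≐-eU′ m<r _ (≐-flipʳ R))
  ... | tri≈ _ x≡y _ = ⊥-elim (≐-distinct P (<⇒≢ i<j) x≡y)
  ... | tri> _ _ y<x = Δᵘ₃ z y x y<x (≐-distinct Q (<⇒≢ k<l) ∘ sym) (≐-distinct R (<⇒≢ m<r) ∘ sym) ,
        zxy (eL-≐ i<j y<x (≐-flipʳ P) , eU-≐-eU′ k<l _ (≐-flipʳ Q) , eU-≐-eU′ m<r _ (≐-flipʳ R))

  Related⇒RK-Δ₂ : ∀ {i j k l : Fin n} {k<l : k < l} →
                  Related (e₀ i) (e₀ j) (eL k l k<l) → RK (e₀ i) (e₀ j) (eL k l k<l)
  Related⇒RK-Δ₂ {i} {j} {k} {l} {k<l} ρ =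
    RK-Δ₂ (singletons-covering⇒≐ (<⇒≢ k<l) (RB⇒covering (short i) (short j) (minus k l k<l) ρ))

  Related⇒RK-Δᵘ₂ : ∀ {i j k l : Fin n} {k<l : k < l} →
                   Related (e₀ i) (e₀ j) (eU k l k<l) → RK (e₀ i) (e₀ j) (eU k l k<l)
  Related⇒RK-Δᵘ₂ {i} {j} {k} {l} {k<l} ρ =
    RK-Δᵘ₂ (singletons-covering⇒≐ (<⇒≢ k<l) (RB⇒covering (short i) (short j) (plus k l k<l) ρ))

  Related⇒RK-Δ₃ : ∀ {i j k l m r : Fin n} {i<j : i < j} {k<l : k < l} {m<r : m < r} →
                  Related (eL i j i<j) (eL k l k<l) (eL m r m<r) → RK (eL i j i<j) (eL k l k<l) (eL m r m<r)
  Related⇒RK-Δ₃ {i} {j} {k} {l} {m} {r} {i<j} {k<l} {m<r} ρ =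
    RK-Δ₃ (covering⇒triangle (<⇒≢ i<j) (<⇒≢ k<l) (<⇒≢ m<r)
      (RB⇒covering (minus i j i<j) (minus k l k<l) (minus m r m<r) ρ))

  Related⇒RK-Δᵘ₃ : ∀ {i j k l m r : Fin n} {i<j : i < j} {k<l : k < l} {m<r : m < r} →
                   Related (eL i j i<j) (eU k l k<l) (eU m r m<r) → RK (eL i j i<j) (eU k l k<l) (eU m r m<r)
  Related⇒RK-Δᵘ₃ {i} {j} {k} {l} {m} {r} {i<j} {k<l} {m<r} ρ =
    RK-Δᵘ₃ (covering⇒triangle (<⇒≢ i<j) (<⇒≢ k<l) (<⇒≢ m<r)
      (RB⇒covering (minus i j i<j) (plus k l k<l) (plus m r m<r) ρ))

  -- In the last seventeen cases the weights of the three roots cannot cancel.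
  Related⇒RK : ∀ (a b c : Edge n) → Related a b c → RK a b c
  Related⇒RK (e₀ _)       (e₀ _)       (eL _ _ _)   ρ = Related⇒RK-Δ₂ ρ
  Related⇒RK a@(e₀ _)     b@(eL _ _ _) c@(e₀ _)     ρ = RK-swap₂₃ (Related⇒RK-Δ₂ (Related-swap₂₃ a b c ρ))
  Related⇒RK a@(eL _ _ _) b@(e₀ _)     c@(e₀ _)     ρ =
    RK-swap₁₂ (RK-swap₂₃ (Related⇒RK-Δ₂ (Related-swap₂₃ b a c (Related-swap₁₂ a b c ρ))))
  Related⇒RK (e₀ _)       (e₀ _)       (eU _ _ _)   ρ = Related⇒RK-Δᵘ₂ ρ
  Related⇒RK a@(e₀ _)     b@(eU _ _ _) c@(e₀ _)     ρ = RK-swap₂₃ (Related⇒RK-Δᵘ₂ (Related-swap₂₃ a b c ρ))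
  Related⇒RK a@(eU _ _ _) b@(e₀ _)     c@(e₀ _)     ρ =
    RK-swap₁₂ (RK-swap₂₃ (Related⇒RK-Δᵘ₂ (Related-swap₂₃ b a c (Related-swap₁₂ a b c ρ))))
  Related⇒RK (eL _ _ _)   (eL _ _ _)   (eL _ _ _)   ρ = Related⇒RK-Δ₃ ρ
  Related⇒RK (eL _ _ _)   (eU _ _ _)   (eU _ _ _)   ρ = Related⇒RK-Δᵘ₃ ρ
  Related⇒RK a@(eU _ _ _) b@(eL _ _ _) c@(eU _ _ _) ρ = RK-swap₁₂ (Related⇒RK-Δᵘ₃ (Related-swap₁₂ a b c ρ))
  Related⇒RK a@(eU _ _ _) b@(eU _ _ _) c@(eL _ _ _) ρ =
    RK-swap₂₃ (RK-swap₁₂ (Related⇒RK-Δᵘ₃ (Related-swap₁₂ a c b (Related-swap₂₃ a b c ρ))))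
  Related⇒RK a@(e₀ _)     b@(e₀ _)     c@(e₀ _)     ρ = ⊥-elim (Related⇒balanced a b c ρ)
  Related⇒RK a@(e₀ _)     b@(eL _ _ _) c@(eL _ _ _) ρ = ⊥-elim (Related⇒balanced a b c ρ)
  Related⇒RK a@(e₀ _)     b@(eL _ _ _) c@(eU _ _ _) ρ = ⊥-elim (Related⇒balanced a b c ρ)
  Related⇒RK a@(e₀ _)     b@(eU _ _ _) c@(eL _ _ _) ρ = ⊥-elim (Related⇒balanced a b c ρ)
  Related⇒RK a@(e₀ _)     b@(eU _ _ _) c@(eU _ _ _) ρ = ⊥-elim (Related⇒balanced a b c ρ)
  Related⇒RK a@(eL _ _ _) b@(e₀ _)     c@(eL _ _ _) ρ = ⊥-elim (Related⇒balanced a b c ρ)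
  Related⇒RK a@(eL _ _ _) b@(e₀ _)     c@(eU _ _ _) ρ = ⊥-elim (Related⇒balanced a b c ρ)
  Related⇒RK a@(eL _ _ _) b@(eL _ _ _) c@(e₀ _)     ρ = ⊥-elim (Related⇒balanced a b c ρ)
  Related⇒RK a@(eL _ _ _) b@(eL _ _ _) c@(eU _ _ _) ρ = ⊥-elim (Related⇒balanced a b c ρ)
  Related⇒RK a@(eL _ _ _) b@(eU _ _ _) c@(e₀ _)     ρ = ⊥-elim (Related⇒balanced a b c ρ)
  Related⇒RK a@(eL _ _ _) b@(eU _ _ _) c@(eL _ _ _) ρ = ⊥-elim (Related⇒balanced a b c ρ)
  Related⇒RK a@(eU _ _ _) b@(e₀ _)     c@(eL _ _ _) ρ = ⊥-elim (Related⇒balanced a b c ρ)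
  Related⇒RK a@(eU _ _ _) b@(e₀ _)     c@(eU _ _ _) ρ = ⊥-elim (Related⇒balanced a b c ρ)
  Related⇒RK a@(eU _ _ _) b@(eL _ _ _) c@(e₀ _)     ρ = ⊥-elim (Related⇒balanced a b c ρ)
  Related⇒RK a@(eU _ _ _) b@(eL _ _ _) c@(eL _ _ _) ρ = ⊥-elim (Related⇒balanced a b c ρ)
  Related⇒RK a@(eU _ _ _) b@(eU _ _ _) c@(e₀ _)     ρ = ⊥-elim (Related⇒balanced a b c ρ)
  Related⇒RK a@(eU _ _ _) b@(eU _ _ _) c@(eU _ _ _) ρ = ⊥-elim (Related⇒balanced a b c ρ)

lemma2p5 : (n : ℕ) → 2 ≤ n →
    Σ (Edge n ⤖ BRoot n) λ φ →
      IsIso (TK n) (TB n) φ ×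
      (∀ (x : BRoot n → ℚ) → InP (TB n) x ⇔ InP (TK n) (x ∘ Bijection.to φ))
lemma2p5 n _ = edge⤖root , edges≅roots , InP-iso (TK n) (TB n) edge⤖root edges≅roots
  where
    edge⤖root : Edge n ⤖ BRoot n
    edge⤖root = ↔⇒⤖ edge↔root
    edges≅roots : IsIso (TK n) (TB n) edge⤖root
    edges≅roots a b c = mk⇔ RK⇒Related (Related⇒RK a b c)
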